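{- For two brooms $T_1,T_2$ on a complete split graph $G$, the weighted graph $H$ contains an $(s,t)$-cut of value $w$ if and only if there exists a point $x\in\{0,1\}^Y$ such that $$\sum_{v\in Y}w_{s,v}+\ell(x)+q(x)=w.$$
   Context: A complete split graph $G$ has vertex set partitioned into $P$ ($|P|=p\ge 1$) inducing a clique and $Q$ inducing an independent set, with every vertex of $P$ adjacent to every vertex of $Q$. A broom on $G$ consists of a handle, a sequence of vertices listed from top (root) to bottom whose elements are exactly $P\cup S$ for some $S\subseteq Q$, with bottommost element in $P$, together with the set $Q\setminus S$ of leaves; $u$ is above $v$ if it comes earlier in the handle. For the fixed brooms $T_1,T_2$: $Y$ is the set of vertices of $Q$ lying in the handles of both; points of $\{0,1\}^Y$ have coordinates $x_u$, $u\in Y$. For $u\in Y$: $C_u$ is the set of vertices of $P$ below $u$ in both $T_1$ and $T_2$; $D_u$ is the set of vertices of $Q\setminus Y$ above $u$ in the handle of $T_1$ or of $T_2$; $E_u$ is the set of vertices of $Y$ above $u$ in one of $T_1,T_2$ and below $u$ in the other; $F_u$ is the set of vertices of $Y$ below $u$ in both. Define $\ell_u=2|C_u|-|D_u|+2|F_u|$ and $\ell(x)=\sum_{u\in Y}\ell_ux_u$. For $u,v\in Y$ let $q_{u,v}=0$ if $u=v$, $q_{u,v}=-1$ if $v\in E_u$, and $q_{u,v}=-2$ otherwise, and $q(x)=\frac12\sum_{u\in Y}\sum_{v\in Y}q_{u,v}x_ux_v$. Let $H$ be the graph on vertex set $Y\cup\{s,t\}$ ($s,t$ new vertices) with an edge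 between every two distinct vertices of $Y$ and between each of $s,t$ and every vertex of $Y$ (no edge $st$). Weights: for $u,v\in Y$, $w_{u,v}=-\frac12 q_{u,v}$ (so $w_{u,u}=0$, $w_{u,v}=1/2$ if $v\in E_u$, and $1$ otherwise); $r_u=-\sum_{v\in Y}w_{u,v}$; $w_{s,v}=\max\{0,-r_v-\ell_v\}$ for $v\in Y$; $w_{u,t}=\max\{0,r_u+\ell_u\}$ for $u\in Y$. An $(s,t)$-cut of value $w$ in $H$ is a bipartition of the vertex set of $H$ with $s$ and $t$ in different parts such that the weights of all edges between the two parts sum to $w$; such a cut is encoded by $x\in\{0,1\}^Y$ with $x_u=1$ iff $u$ is in the part containing $s$. -}

module Defs where

open import Data.Bool using (Bool; true; false; _∧_; _∨_; not; if_then_else_; T; T?; _xor_)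
open import Data.Nat as ℕ using (ℕ; zero; suc; _<ᵇ_)
open import Data.Fin as Fin using (Fin; toℕ)
open import Data.Fin.Properties as FinP using ()
open import Data.Sum using (_⊎_; inj₁; inj₂)
open import Data.Sum.Properties using (≡-dec)
open import Data.Product using (Σ; ∃; _,_; proj₁; _×_)
open import Data.List using (List; []; _∷_; last)
open import Data.List.Relation.Unary.Unique.Propositional using (Unique)
open import Data.List.Membership.Propositional using (_∈_)
open import Data.Maybe using (Maybe; just)
open import Data.Integer using (+_)
open import Data.Rational using (ℚ; 0ℚ; 1ℚ; ½; _+_; _*_; -_; _-_; _⊔_; _/_)
open import Relation.Nullary using (Dec; yes; no; does)
open import Relation.Binary.PropositionalEquality using (_≡_; _≢_)

-- Vertices of the complete split graph G: P = Fin p (clique), Q = Fin m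
-- (independent set); every P-vertex adjacent to every Q-vertex.
-- (The adjacency itself plays no role in the definition of brooms.)
V : ℕ → ℕ → Set
V p m = Fin p ⊎ Fin m

_≟V_ : ∀ {p m} (a b : V p m) → Bool
a ≟V b = does (≡-dec FinP._≟_ FinP._≟_ a b)

-- A broom on G: a handle (list, top = head) with no repetitions, containing
-- every vertex of P (its Q-elements form S), bottommost element in P.
-- The leaves are the Q-vertices not in the handle.
record Broom (p m : ℕ) : Set where
  field
    handle   : List (V p m)
    unique   : Unique handle
    coversP  : ∀ (i : Fin p) → inj₁ i ∈ handle
    bottomP  : ∃ λ (i : Fin p) → last handle ≡ just (inj₁ i)

inL : ∀ {p m} → V p m → List (V p m) → Bool
inL v []      = false
inL v (a ∷ h) = (a ≟V v) ∨ inL v h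

above : ∀ {p m} → List (V p m) → V p m → V p m → Bool
above []      u v = false
above (a ∷ h) u v =
  if (a ≟V u) then inL v h else (if (a ≟V v) then false else above h u v)

sumFin : (n : ℕ) → (Fin n → ℚ) → ℚ
sumFin zero    f = 0ℚ
sumFin (suc n) f = f Fin.zero + sumFin n (λ i → f (Fin.suc i))

ℕ→ℚ : ℕ → ℚ
ℕ→ℚ n = (+ n) / 1

count : (n : ℕ) → (Fin n → Bool) → ℕ
count zero    f = 0
count (suc n) f = (if f Fin.zero then 1 else 0) ℕ.+ count n (λ i → f (Fin.suc i))

b→ℚ : Bool → ℚ
b→ℚ true  = 1ℚ
b→ℚ false = 0ℚ

module Setup {p m : ℕ} (T₁ T₂ : Broom p m) where
  h₁ = Broom.handle T₁
  h₂ = Broom.handle T₂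

  inY : Fin m → Bool
  inY u = inL (inj₂ u) h₁ ∧ inL (inj₂ u) h₂

  Yt : Set
  Yt = Σ (Fin m) (λ u → T (inY u))

  private
    restrict : (Yt → ℚ) → (u : Fin m) → Dec (T (inY u)) → ℚ
    restrict f u (yes pr) = f (u , pr)
    restrict f u (no _)   = 0ℚ

  sumY : (Yt → ℚ) → ℚ
  sumY f = sumFin m (λ u → restrict f u (T? (inY u)))

  private
    countY : (Fin m → Bool) → ℕ
    countY f = count m (λ v → inY v ∧ f v)

  Q̂ : Fin m → V p m
  Q̂ = inj₂

  Ccard : Yt → ℕ
  Ccard (u , _) = count p (λ i → above h₁ (Q̂ u) (inj₁ i) ∧ above h₂ (Q̂ u) (inj₁ i))

  Dcard : Yt → ℕ
  Dcard (u , _) = count m (λ v → not (inY v) ∧ (above h₁ (Q̂ v) (Q̂ u) ∨ above h₂ (Q̂ v) (Q̂ u)))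

  inE : Yt → Yt → Bool
  inE (u , _) (v , _) =
    (above h₁ (Q̂ v) (Q̂ u) ∧ above h₂ (Q̂ u) (Q̂ v)) ∨ (above h₁ (Q̂ u) (Q̂ v) ∧ above h₂ (Q̂ v) (Q̂ u))

  Fcard : Yt → ℕ
  Fcard (u , _) = countY (λ v → above h₁ (Q̂ u) (Q̂ v) ∧ above h₂ (Q̂ u) (Q̂ v))

  ℓ : Yt → ℚ
  ℓ u = ℕ→ℚ (2 ℕ.* Ccard u) - ℕ→ℚ (Dcard u) + ℕ→ℚ (2 ℕ.* Fcard u)

  qc : Yt → Yt → ℚ
  qc u v = if (toℕ (proj₁ u) ℕ.≡ᵇ toℕ (proj₁ v)) then 0ℚ
           else (if inE u v then - 1ℚ else - (1ℚ + 1ℚ))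

  ℓx : (Yt → Bool) → ℚ
  ℓx x = sumY (λ u → ℓ u * b→ℚ (x u))

  qx : (Yt → Bool) → ℚ
  qx x = ½ * sumY (λ u → sumY (λ v → qc u v * b→ℚ (x u) * b→ℚ (x v)))

  wYY : Yt → Yt → ℚ
  wYY u v = - (½ * qc u v)

  r : Yt → ℚ
  r u = - sumY (λ v → wYY u v)

  ws : Yt → ℚ
  ws v = 0ℚ ⊔ (- r v - ℓ v)

  wt : Yt → ℚ
  wt u = 0ℚ ⊔ (r u + ℓ u)

  data HV : Set where
    s t : HV
    y   : Yt → HV

  crossing : (HV → Bool) → HV → HV → ℚ
  crossing side a b = b→ℚ (side a xor side b)

  cutValue : (HV → Bool) → ℚ
  cutValue side =
      sumY (λ u → sumY (λ v →
         if (toℕ (proj₁ u) <ᵇ toℕ (proj₁ v)) then crossing side (y u) (y v) * wYY u v else 0ℚ))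
    + sumY (λ v → crossing side s (y v) * ws v)
    + sumY (λ u → crossing side (y u) t * wt u)

  HasCut : ℚ → Set
  HasCut w = ∃ λ (side : HV → Bool) → (side s ≢ side t) × cutValue side ≡ w

{-# OPTIONS --safe #-}
-- Encode a cut by x u = true iff u is on the side of s.  An edge uv inside Y
-- is cut iff x_u xor x_v = x_u + x_v - 2 x_u x_v; as w is symmetric with zero
-- diagonal, summing over unordered pairs gives
-- Σ_u x_u Σ_v w_uv - Σ_{u,v} x_u x_v w_uv = -Σ_u x_u r_u + q(x).  The edges at
-- s and t contribute Σ_v (1 - x_v) w_sv + Σ_u x_u w_ut, and
-- max(0, a) = max(0, -a) + a turns this into Σ_v w_sv + Σ_u x_u (r_u + ℓ_u),
-- so the r-terms cancel.
module Submission where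

open import Defs
open import Data.Nat using (ℕ; _≤_)
open import Data.Product using (∃; _×_)
open import Data.Bool using (Bool)
open import Data.Rational using (ℚ; _+_)
open import Relation.Binary.PropositionalEquality using (_≡_)
open import Function.Bundles using (_⇔_)

open import Algebra.Bundles using (CommutativeMonoid)
open import Data.Nat using (zero; suc; _<ᵇ_; _≡ᵇ_)
open import Data.Nat.Properties using (≡⇒≡ᵇ)
open import Data.Fin as Fin using (Fin; toℕ)
open import Data.Bool using (true; false; not; _∧_; _xor_; T; T?; if_then_else_)
open import Data.Bool.Properties using (xor-comm; xor-identityʳ; ∨-comm)
open import Data.Product using (Σ; _,_; proj₁)
open import Data.Sum using (inj₁; inj₂)
open import Data.Empty using (⊥-elim)
open import Data.Rational using (_*_; -_; _-_; 0ℚ; 1ℚ; ½; _⊔_)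
import Data.Rational.Properties as ℚ
open import Relation.Nullary using (Dec; yes; no)
open import Relation.Binary.PropositionalEquality
  using (refl; sym; trans; cong; cong₂; _≢_; module ≡-Reasoning)
open import Function.Bundles using (mk⇔)
open import Algebra.Properties.CommutativeSemigroup
  (CommutativeMonoid.commutativeSemigroup ℚ.+-0-commutativeMonoid) using (interchange)
open import Algebra.Properties.Ring ℚ.+-*-ring using (-1*x≈-x)
open import Algebra.Solver.Ring.AlmostCommutativeRing using (fromCommutativeRing)
open import Algebra.Solver.Ring.Simple (fromCommutativeRing ℚ.+-*-commutativeRing) ℚ._≟_
  using (solve; _:+_; _:*_; :-_; _:-_; _:=_; con)

open ≡-Reasoning

sumFin-cong : ∀ n {f g : Fin n → ℚ} → (∀ i → f i ≡ g i) → sumFin n f ≡ sumFin n g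
sumFin-cong zero    f≗g = refl
sumFin-cong (suc n) f≗g = cong₂ _+_ (f≗g Fin.zero) (sumFin-cong n (λ i → f≗g (Fin.suc i)))

sumFin-zero : ∀ n → sumFin n (λ _ → 0ℚ) ≡ 0ℚ
sumFin-zero zero    = refl
sumFin-zero (suc n) = cong (0ℚ +_) (sumFin-zero n)

sumFin-+ : ∀ n (f g : Fin n → ℚ) → sumFin n (λ i → f i + g i) ≡ sumFin n f + sumFin n g
sumFin-+ zero    f g = refl
sumFin-+ (suc n) f g = trans
  (cong (f Fin.zero + g Fin.zero +_) (sumFin-+ n (λ i → f (Fin.suc i)) (λ i → g (Fin.suc i))))
  (interchange (f Fin.zero) (g Fin.zero) _ _)

sumFin-*ˡ : ∀ n c (f : Fin n → ℚ) → sumFin n (λ i → c * f i) ≡ c * sumFin n f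
sumFin-*ˡ zero    c f = sym (ℚ.*-zeroʳ c)
sumFin-*ˡ (suc n) c f = trans
  (cong (c * f Fin.zero +_) (sumFin-*ˡ n c (λ i → f (Fin.suc i))))
  (sym (ℚ.*-distribˡ-+ c _ _))

sumFin-swap : ∀ n k (F : Fin n → Fin k → ℚ) →
  sumFin n (λ i → sumFin k (F i)) ≡ sumFin k (λ j → sumFin n (λ i → F i j))
sumFin-swap zero    k F = sym (sumFin-zero k)
sumFin-swap (suc n) k F = trans
  (cong (sumFin k (F Fin.zero) +_) (sumFin-swap n k (λ i → F (Fin.suc i))))
  (sym (sumFin-+ k _ _))

module _ {n : ℕ} {P : Fin n → Set} (P? : ∀ i → Dec (P i)) where

  extendByZero : (Σ (Fin n) P → ℚ) → Fin n → ℚ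
  extendByZero f i with P? i
  ... | yes Pi = f (i , Pi)
  ... | no _   = 0ℚ

  extendByZero-cong : ∀ {f g : Σ (Fin n) P → ℚ} → (∀ a → f a ≡ g a) →
                      ∀ i → extendByZero f i ≡ extendByZero g i
  extendByZero-cong f≗g i with P? i
  ... | yes Pi = f≗g (i , Pi)
  ... | no _   = refl

  extendByZero-+ : ∀ (f g : Σ (Fin n) P → ℚ) i →
                   extendByZero (λ a → f a + g a) i ≡ extendByZero f i + extendByZero g i
  extendByZero-+ f g i with P? i
  ... | yes _ = refl
  ... | no _  = refl

  extendByZero-*ˡ : ∀ c (f : Σ (Fin n) P → ℚ) i →
                    extendByZero (λ a → c * f a) i ≡ c * extendByZero f i
  extendByZero-*ˡ c f i with P? i
  ... | yes _ = refl
  ... | no _  = sym (ℚ.*-zeroʳ c)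

  extendByZero-sumFin : ∀ k (F : Σ (Fin n) P → Fin k → ℚ) i →
    extendByZero (λ a → sumFin k (F a)) i ≡ sumFin k (λ j → extendByZero (λ a → F a j) i)
  extendByZero-sumFin k F i with P? i
  ... | yes _ = refl
  ... | no _  = sym (sumFin-zero k)

  extendByZero-comm : ∀ (F : Σ (Fin n) P → Σ (Fin n) P → ℚ) i j →
    extendByZero (λ a → extendByZero (F a) j) i ≡ extendByZero (λ b → extendByZero (λ a → F a b) i) j
  extendByZero-comm F i j with P? i | P? j
  ... | yes _ | yes _ = refl
  ... | yes _ | no _  = refl
  ... | no _  | yes _ = refl
  ... | no _  | no _  = refl

ordered-pair-split : ∀ a b (g : ℚ) → (a ≡ b → g ≡ 0ℚ) →
  (if a <ᵇ b then g else 0ℚ) + (if b <ᵇ a then g else 0ℚ) ≡ g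
ordered-pair-split zero    zero    g diagonal = sym (diagonal refl)
ordered-pair-split zero    (suc b) g diagonal = ℚ.+-identityʳ g
ordered-pair-split (suc a) zero    g diagonal = ℚ.+-identityˡ g
ordered-pair-split (suc a) (suc b) g diagonal = ordered-pair-split a b g (λ a≡b → diagonal (cong suc a≡b))

≡ᵇ-sym : ∀ a b → (a ≡ᵇ b) ≡ (b ≡ᵇ a)
≡ᵇ-sym zero    zero    = refl
≡ᵇ-sym zero    (suc b) = refl
≡ᵇ-sym (suc a) zero    = refl
≡ᵇ-sym (suc a) (suc b) = ≡ᵇ-sym a b

xor-cancelʳ : ∀ a b c → (a xor c) xor (b xor c) ≡ a xor b
xor-cancelʳ true  true  true  = refl
xor-cancelʳ true  true  false = refl
xor-cancelʳ true  false true  = refl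
xor-cancelʳ true  false false = refl
xor-cancelʳ false true  true  = refl
xor-cancelʳ false true  false = refl
xor-cancelʳ false false true  = refl
xor-cancelʳ false false false = refl

xor-≢ : ∀ {b c} a → b ≢ c → b xor a ≡ not (a xor c)
xor-≢ {true}  {true}  a b≢c = ⊥-elim (b≢c refl)
xor-≢ {false} {false} a b≢c = ⊥-elim (b≢c refl)
xor-≢ {true}  {false} a b≢c = cong not (sym (xor-identityʳ a))
xor-≢ {false} {true}  true  b≢c = refl
xor-≢ {false} {true}  false b≢c = refl

b→ℚ-not : ∀ b → b→ℚ (not b) ≡ 1ℚ - b→ℚ b
b→ℚ-not true  = refl
b→ℚ-not false = refl

b→ℚ-xor : ∀ a b → b→ℚ (a xor b) ≡ b→ℚ a + b→ℚ b - (1ℚ + 1ℚ) * (b→ℚ a * b→ℚ b)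
b→ℚ-xor true  true  = refl
b→ℚ-xor true  false = refl
b→ℚ-xor false true  = refl
b→ℚ-xor false false = refl

0⊔-split : ∀ a → 0ℚ ⊔ a ≡ 0ℚ ⊔ (- a) + a
0⊔-split a with ℚ.≤-total 0ℚ a
... | inj₁ 0≤a = begin
  0ℚ ⊔ a          ≡⟨ ℚ.p≤q⇒p⊔q≡q 0≤a ⟩
  a               ≡⟨ ℚ.+-identityˡ a ⟨
  0ℚ + a          ≡⟨ cong (_+ a) (ℚ.p≥q⇒p⊔q≡p (ℚ.neg-antimono-≤ 0≤a)) ⟨
  0ℚ ⊔ (- a) + a  ∎
... | inj₂ a≤0 = begin
  0ℚ ⊔ a          ≡⟨ ℚ.p≥q⇒p⊔q≡p a≤0 ⟩
  0ℚ              ≡⟨ ℚ.+-inverseˡ a ⟨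
  - a + a         ≡⟨ cong (_+ a) (ℚ.p≤q⇒p⊔q≡q (ℚ.neg-antimono-≤ a≤0)) ⟨
  0ℚ ⊔ (- a) + a  ∎

double-half : ∀ a → a ≡ ½ * (a + a)
double-half = solve 1 (λ a → a := con ½ :* (a :+ a)) refl

half-of-double-+ : ∀ a b → ½ * (a + a + b) ≡ a + ½ * b
half-of-double-+ = solve 2 (λ a b → con ½ :* (a :+ a :+ b) := a :+ con ½ :* b) refl

crossing-weight : ∀ α β q →
  (α + β - (1ℚ + 1ℚ) * (α * β)) * - (½ * q) ≡ α * - (½ * q) + β * - (½ * q) + q * α * β
crossing-weight = solve 3 (λ α β q →
  (α :+ β :- (con 1ℚ :+ con 1ℚ) :* (α :* β)) :* :- (con ½ :* q)
    := α :* :- (con ½ :* q) :+ β :* :- (con ½ :* q) :+ q :* α :* β) refl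

terminal-weight : ∀ β W R L → (1ℚ - β) * W + β * (W + (R + L)) ≡ W + (L * β + β * R)
terminal-weight = solve 4 (λ β W R L →
  (con 1ℚ :- β) :* W :+ β :* (W :+ (R :+ L)) := W :+ (L :* β :+ β :* R)) refl

cancel-incident : ∀ I Q W L → (I + Q) + (W + (L + - I)) ≡ W + L + Q
cancel-incident = solve 4 (λ I Q W L → (I :+ Q) :+ (W :+ (L :+ :- I)) := W :+ L :+ Q) refl

-- The summands of `Setup.sumY` are a private restriction in Defs; they are
-- recovered here from the defining equation of the sum.
summandOf : ∀ {n} {s : ℚ} {F : Fin n → ℚ} → s ≡ sumFin n F → Fin n → ℚ
summandOf {F = F} _ = F

module SumOverY {p m : ℕ} (T₁ T₂ : Broom p m) where
  open Setup T₁ T₂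

  private
    Y? : ∀ u → Dec (T (inY u))
    Y? u = T? (inY u)

    extend : (Yt → ℚ) → Fin m → ℚ
    extend = extendByZero Y?

  sumY-as-sumFin : ∀ f → sumY f ≡ sumFin m (extend f)
  sumY-as-sumFin f = sumFin-cong m summand≡extend
    where
    summand≡extend : ∀ u → summandOf {s = sumY f} refl u ≡ extend f u
    summand≡extend u with T? (inY u)
    ... | yes _ = refl
    ... | no _  = refl

  sumY-cong : ∀ {f g : Yt → ℚ} → (∀ a → f a ≡ g a) → sumY f ≡ sumY g
  sumY-cong {f} {g} f≗g = begin
    sumY f                  ≡⟨ sumY-as-sumFin f ⟩
    sumFin m (extend f)     ≡⟨ sumFin-cong m (extendByZero-cong Y? f≗g) ⟩
    sumFin m (extend g)     ≡⟨ sumY-as-sumFin g ⟨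
    sumY g                  ∎

  sumY-+ : ∀ (f g : Yt → ℚ) → sumY (λ a → f a + g a) ≡ sumY f + sumY g
  sumY-+ f g = begin
    sumY (λ a → f a + g a)                ≡⟨ sumY-as-sumFin _ ⟩
    sumFin m (extend (λ a → f a + g a))   ≡⟨ sumFin-cong m (extendByZero-+ Y? f g) ⟩
    sumFin m (λ u → extend f u + extend g u) ≡⟨ sumFin-+ m (extend f) (extend g) ⟩
    sumFin m (extend f) + sumFin m (extend g) ≡⟨ cong₂ _+_ (sumY-as-sumFin f) (sumY-as-sumFin g) ⟨
    sumY f + sumY g                       ∎

  sumY-*ˡ : ∀ c (f : Yt → ℚ) → sumY (λ a → c * f a) ≡ c * sumY f
  sumY-*ˡ c f = begin
    sumY (λ a → c * f a)               ≡⟨ sumY-as-sumFin _ ⟩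
    sumFin m (extend (λ a → c * f a))  ≡⟨ sumFin-cong m (extendByZero-*ˡ Y? c f) ⟩
    sumFin m (λ u → c * extend f u)    ≡⟨ sumFin-*ˡ m c (extend f) ⟩
    c * sumFin m (extend f)            ≡⟨ cong (c *_) (sumY-as-sumFin f) ⟨
    c * sumY f                         ∎

  sumY-neg : ∀ (f : Yt → ℚ) → sumY (λ a → - f a) ≡ - sumY f
  sumY-neg f = begin
    sumY (λ a → - f a)        ≡⟨ sumY-cong (λ a → -1*x≈-x (f a)) ⟨
    sumY (λ a → - 1ℚ * f a)   ≡⟨ sumY-*ˡ (- 1ℚ) f ⟩
    - 1ℚ * sumY f             ≡⟨ -1*x≈-x (sumY f) ⟩
    - sumY f                  ∎

  sumY-swap : ∀ (F : Yt → Yt → ℚ) →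
              sumY (λ a → sumY (F a)) ≡ sumY (λ b → sumY (λ a → F a b))
  sumY-swap F = begin
    sumY (λ a → sumY (F a))
      ≡⟨ sumY-as-sumFin _ ⟩
    sumFin m (extend (λ a → sumY (F a)))
      ≡⟨ sumFin-cong m (extendByZero-cong Y? (λ a → sumY-as-sumFin (F a))) ⟩
    sumFin m (extend (λ a → sumFin m (extend (F a))))
      ≡⟨ sumFin-cong m (extendByZero-sumFin Y? m (λ a → extend (F a))) ⟩
    sumFin m (λ i → sumFin m (λ j → extend (λ a → extend (F a) j) i))
      ≡⟨ sumFin-swap m m _ ⟩
    sumFin m (λ j → sumFin m (λ i → extend (λ a → extend (F a) j) i))
      ≡⟨ sumFin-cong m (λ j → sumFin-cong m (λ i → extendByZero-comm Y? F i j)) ⟩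
    sumFin m (λ j → sumFin m (λ i → extend (λ b → extend (λ a → F a b) i) j))
      ≡⟨ sumFin-cong m (extendByZero-sumFin Y? m (λ b → extend (λ a → F a b))) ⟨
    sumFin m (extend (λ b → sumFin m (extend (λ a → F a b))))
      ≡⟨ sumFin-cong m (extendByZero-cong Y? (λ b → sumY-as-sumFin (λ a → F a b))) ⟨
    sumFin m (extend (λ b → sumY (λ a → F a b)))
      ≡⟨ sumY-as-sumFin _ ⟨
    sumY (λ b → sumY (λ a → F a b))
      ∎

  sumY²-+ : ∀ (F G : Yt → Yt → ℚ) →
    sumY (λ u → sumY (λ v → F u v + G u v)) ≡ sumY (λ u → sumY (F u)) + sumY (λ u → sumY (G u))
  sumY²-+ F G = trans (sumY-cong (λ u → sumY-+ (F u) (G u))) (sumY-+ _ _)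

module CutEnergy {p m : ℕ} (T₁ T₂ : Broom p m) where
  open Setup T₁ T₂
  open SumOverY T₁ T₂

  index : Yt → ℕ
  index u = toℕ (proj₁ u)

  inE-sym : ∀ u v → inE u v ≡ inE v u
  inE-sym (u , _) (v , _) =
    ∨-comm (above h₁ (Q̂ v) (Q̂ u) ∧ above h₂ (Q̂ u) (Q̂ v)) (above h₁ (Q̂ u) (Q̂ v) ∧ above h₂ (Q̂ v) (Q̂ u))

  wYY-sym : ∀ u v → wYY u v ≡ wYY v u
  wYY-sym u v = cong₂ (λ diagonal crossed → - (½ * (if diagonal then 0ℚ else (if crossed then - 1ℚ else - (1ℚ + 1ℚ)))))
                      (≡ᵇ-sym (index u) (index v)) (inE-sym u v)

  wYY-diagonal : ∀ u v → index u ≡ index v → wYY u v ≡ 0ℚ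
  wYY-diagonal u v eq with toℕ (proj₁ u) ≡ᵇ toℕ (proj₁ v) | ≡⇒≡ᵇ (index u) (index v) eq
  ... | true | _ = refl

  sumY-ordered-pairs : (G : Yt → Yt → ℚ) → (∀ u v → G u v ≡ G v u) →
    (∀ u v → index u ≡ index v → G u v ≡ 0ℚ) →
    sumY (λ u → sumY (λ v → if index u <ᵇ index v then G u v else 0ℚ)) ≡ ½ * sumY (λ u → sumY (G u))
  sumY-ordered-pairs G G-sym G-diagonal = begin
    A                                                  ≡⟨ double-half A ⟩
    ½ * (A + A)                                        ≡⟨ cong (λ z → ½ * (A + z)) (sumY-swap below) ⟩
    ½ * (A + sumY (λ u → sumY (λ v → below v u)))      ≡⟨ cong (½ *_) (sumY²-+ below (λ u v → below v u)) ⟨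
    ½ * sumY (λ u → sumY (λ v → below u v + below v u)) ≡⟨ cong (½ *_) (sumY-cong (λ u → sumY-cong (both-orders u))) ⟩
    ½ * sumY (λ u → sumY (G u))                        ∎
    where
    below : Yt → Yt → ℚ
    below u v = if index u <ᵇ index v then G u v else 0ℚ

    A : ℚ
    A = sumY (λ u → sumY (below u))

    both-orders : ∀ u v → below u v + below v u ≡ G u v
    both-orders u v = trans
      (cong (λ g → below u v + (if index v <ᵇ index u then g else 0ℚ)) (G-sym v u))
      (ordered-pair-split (index u) (index v) (G u v) (G-diagonal u v))

  cutYY cutSY cutYT : (Yt → Bool) → ℚ
  cutYY x = sumY (λ u → sumY (λ v → if index u <ᵇ index v then b→ℚ (x u xor x v) * wYY u v else 0ℚ))
  cutSY x = sumY (λ v → b→ℚ (not (x v)) * ws v)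
  cutYT x = sumY (λ u → b→ℚ (x u) * wt u)

  incidentWeight : (Yt → Bool) → ℚ
  incidentWeight x = sumY (λ u → sumY (λ v → b→ℚ (x u) * wYY u v))

  cutYY≡ : ∀ x → cutYY x ≡ incidentWeight x + qx x
  cutYY≡ x = begin
    cutYY x
      ≡⟨ sumY-ordered-pairs G G-sym G-diagonal ⟩
    ½ * sumY (λ u → sumY (G u))
      ≡⟨ cong (½ *_) (sumY-cong (λ u → sumY-cong (expand u))) ⟩
    ½ * sumY (λ u → sumY (λ v → X u * wYY u v + X v * wYY u v + qc u v * X u * X v))
      ≡⟨ cong (½ *_) (trans (sumY²-+ _ _) (cong (_+ S₂) (sumY²-+ _ _))) ⟩
    ½ * (incidentWeight x + sumY (λ u → sumY (λ v → X v * wYY u v)) + S₂)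
      ≡⟨ cong (λ z → ½ * (incidentWeight x + z + S₂)) incoming≡outgoing ⟩
    ½ * (incidentWeight x + incidentWeight x + S₂)
      ≡⟨ half-of-double-+ (incidentWeight x) S₂ ⟩
    incidentWeight x + qx x
      ∎
    where
    X : Yt → ℚ
    X u = b→ℚ (x u)

    S₂ : ℚ
    S₂ = sumY (λ u → sumY (λ v → qc u v * X u * X v))

    G : Yt → Yt → ℚ
    G u v = b→ℚ (x u xor x v) * wYY u v

    G-sym : ∀ u v → G u v ≡ G v u
    G-sym u v = cong₂ _*_ (cong b→ℚ (xor-comm (x u) (x v))) (wYY-sym u v)

    G-diagonal : ∀ u v → index u ≡ index v → G u v ≡ 0ℚ
    G-diagonal u v eq = trans (cong (b→ℚ (x u xor x v) *_) (wYY-diagonal u v eq)) (ℚ.*-zeroʳ (b→ℚ (x u xor x v)))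

    expand : ∀ u v → G u v ≡ X u * wYY u v + X v * wYY u v + qc u v * X u * X v
    expand u v = trans (cong (_* wYY u v) (b→ℚ-xor (x u) (x v))) (crossing-weight (X u) (X v) (qc u v))

    incoming≡outgoing : sumY (λ u → sumY (λ v → X v * wYY u v)) ≡ incidentWeight x
    incoming≡outgoing = trans (sumY-swap _)
      (sumY-cong (λ u → sumY-cong (λ v → cong (X u *_) (wYY-sym v u))))

  wt≡ws+ : ∀ u → wt u ≡ ws u + (r u + ℓ u)
  wt≡ws+ u = begin
    0ℚ ⊔ (r u + ℓ u)                   ≡⟨ 0⊔-split (r u + ℓ u) ⟩
    0ℚ ⊔ (- (r u + ℓ u)) + (r u + ℓ u) ≡⟨ cong (λ z → 0ℚ ⊔ z + (r u + ℓ u)) (ℚ.neg-distrib-+ (r u) (ℓ u)) ⟩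
    ws u + (r u + ℓ u)                 ∎

  sumY-x*r : ∀ x → sumY (λ u → b→ℚ (x u) * r u) ≡ - incidentWeight x
  sumY-x*r x = begin
    sumY (λ u → b→ℚ (x u) * - sumY (wYY u))
      ≡⟨ sumY-cong (λ u → ℚ.neg-distribʳ-* (b→ℚ (x u)) (sumY (wYY u))) ⟨
    sumY (λ u → - (b→ℚ (x u) * sumY (wYY u)))
      ≡⟨ sumY-cong (λ u → cong -_ (sumY-*ˡ (b→ℚ (x u)) (wYY u))) ⟨
    sumY (λ u → - sumY (λ v → b→ℚ (x u) * wYY u v))
      ≡⟨ sumY-neg _ ⟩
    - incidentWeight x
      ∎

  cutSY+cutYT≡ : ∀ x → cutSY x + cutYT x ≡ sumY ws + (ℓx x + - incidentWeight x)
  cutSY+cutYT≡ x = begin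
    cutSY x + cutYT x
      ≡⟨ sumY-+ _ _ ⟨
    sumY (λ u → b→ℚ (not (x u)) * ws u + b→ℚ (x u) * wt u)
      ≡⟨ sumY-cong terminal-edges ⟩
    sumY (λ u → ws u + (ℓ u * b→ℚ (x u) + b→ℚ (x u) * r u))
      ≡⟨ trans (sumY-+ _ _) (cong (sumY ws +_) (sumY-+ _ _)) ⟩
    sumY ws + (ℓx x + sumY (λ u → b→ℚ (x u) * r u))
      ≡⟨ cong (λ z → sumY ws + (ℓx x + z)) (sumY-x*r x) ⟩
    sumY ws + (ℓx x + - incidentWeight x)
      ∎
    where
    terminal-edges : ∀ u → b→ℚ (not (x u)) * ws u + b→ℚ (x u) * wt u
                         ≡ ws u + (ℓ u * b→ℚ (x u) + b→ℚ (x u) * r u)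
    terminal-edges u = trans
      (cong₂ (λ a b → a * ws u + b→ℚ (x u) * b) (b→ℚ-not (x u)) (wt≡ws+ u))
      (terminal-weight (b→ℚ (x u)) (ws u) (r u) (ℓ u))

  cut-energy : ∀ x → cutYY x + cutSY x + cutYT x ≡ sumY ws + ℓx x + qx x
  cut-energy x = begin
    cutYY x + cutSY x + cutYT x
      ≡⟨ ℚ.+-assoc (cutYY x) (cutSY x) (cutYT x) ⟩
    cutYY x + (cutSY x + cutYT x)
      ≡⟨ cong₂ _+_ (cutYY≡ x) (cutSY+cutYT≡ x) ⟩
    (incidentWeight x + qx x) + (sumY ws + (ℓx x + - incidentWeight x))
      ≡⟨ cancel-incident (incidentWeight x) (qx x) (sumY ws) (ℓx x) ⟩
    sumY ws + ℓx x + qx x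
      ∎

  Encodes : (Yt → Bool) → (HV → Bool) → Set
  Encodes x side = (∀ u → side s xor side (y u) ≡ not (x u)) × (∀ u → side (y u) xor side t ≡ x u)

  cutValue≡energy : ∀ {x} side → Encodes x side → cutValue side ≡ sumY ws + ℓx x + qx x
  cutValue≡energy {x} side (sourceSide , sinkSide) = trans
    (cong₂ _+_ (cong₂ _+_ (sumY-cong (λ u → sumY-cong (yy-edge u))) (sumY-cong sy-edge))
               (sumY-cong yt-edge))
    (cut-energy x)
    where
    yy-edge : ∀ u v → (if index u <ᵇ index v then crossing side (y u) (y v) * wYY u v else 0ℚ)
                    ≡ (if index u <ᵇ index v then b→ℚ (x u xor x v) * wYY u v else 0ℚ)
    yy-edge u v = cong (λ c → if index u <ᵇ index v then b→ℚ c * wYY u v else 0ℚ)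
      (trans (sym (xor-cancelʳ (side (y u)) (side (y v)) (side t))) (cong₂ _xor_ (sinkSide u) (sinkSide v)))

    sy-edge : ∀ v → crossing side s (y v) * ws v ≡ b→ℚ (not (x v)) * ws v
    sy-edge v = cong (λ c → b→ℚ c * ws v) (sourceSide v)

    yt-edge : ∀ u → crossing side (y u) t * wt u ≡ b→ℚ (x u) * wt u
    yt-edge u = cong (λ c → b→ℚ c * wt u) (sinkSide u)

  pointOf : (HV → Bool) → Yt → Bool
  pointOf side u = side (y u) xor side t

  encodes-pointOf : ∀ side → side s ≢ side t → Encodes (pointOf side) side
  encodes-pointOf side s≢t = (λ u → xor-≢ (side (y u)) s≢t) , (λ _ → refl)

  cutOf : (Yt → Bool) → HV → Bool
  cutOf x s     = true
  cutOf x t     = false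
  cutOf x (y u) = x u

  encodes-cutOf : ∀ x → Encodes x (cutOf x)
  encodes-cutOf x = (λ _ → refl) , (λ u → xor-identityʳ (x u))

lemma5p1 : (p m : ℕ) → 1 ≤ p → (T₁ T₂ : Broom p m) → (w : ℚ) →
    Setup.HasCut T₁ T₂ w
      ⇔ (∃ λ (x : Setup.Yt T₁ T₂ → Bool) →
           Setup.sumY T₁ T₂ (Setup.ws T₁ T₂) + Setup.ℓx T₁ T₂ x + Setup.qx T₁ T₂ x ≡ w)
lemma5p1 p m _ T₁ T₂ w = mk⇔
  (λ (side , s≢t , value) → pointOf side , trans (sym (cutValue≡energy side (encodes-pointOf side s≢t))) value)
  (λ (x , value) → cutOf x , (λ ()) , trans (cutValue≡energy (cutOf x) (encodes-cutOf x)) value)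
  where open CutEnergy T₁ T₂
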